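{- Let $a$ and $b$ be relatively prime integers with $a>b\ge1$, and let $S=\{a,b\}$. The Frobenius values with respect to $S$ of length $\lfloor (a+b)/2\rfloor$ are as follows. (i) If $a+b$ is even, there are exactly $b-1$ Frobenius values of length $(a+b)/2$, namely \[ c=\alpha a+\Big(\alpha-\frac{a+b}{2}\Big)b,\qquad \alpha=1,2,\dots,b-1. \] (ii) If $a+b$ is odd, there are exactly $2(b-1)$ Frobenius values of length $(a+b-1)/2$, namely \[ c=\alpha a+\Big(\alpha-\frac{a+b\mp1}{2}\Big)b,\qquad \alpha=1,2,\dots,b-1. \]
   Context: The length $\ell(c)$ of an integer $c$ with respect to $S=\{a,b\}$ is $\min\{|x|+|y| : x,y\in\mathbb{Z},\ c=xa+yb\}$ (the least number of elements of $\{a,b,-a,-b\}$ summing to $c$). An integer $c$ is a Frobenius value with respect to $S$ if it is neither of the form $xa+yb$ with integers $x,y\ge0$ nor of the form $xa+yb$ with integers $x,y\le0$. -}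

module Defs where

open import Data.Nat using (ℕ)
open import Data.Integer using (ℤ; _+_; _*_; _≤_; ∣_∣; 0ℤ)
open import Data.Product using (Σ; _×_; ∃-syntax)
open import Relation.Binary.PropositionalEquality using (_≡_)
open import Relation.Nullary using (¬_)
import Data.Nat as N

Rep : ℤ → ℤ → ℤ → ℤ → ℤ → Set
Rep a b c x y = c ≡ x * a + y * b

HasLength : ℤ → ℤ → ℤ → ℕ → Set
HasLength a b c n =
  (∃[ x ] ∃[ y ] (Rep a b c x y × (∣ x ∣ N.+ ∣ y ∣ ≡ n)))
  × (∀ x y → Rep a b c x y → n N.≤ ∣ x ∣ N.+ ∣ y ∣)

IsFrobeniusValue : ℤ → ℤ → ℤ → Set
IsFrobeniusValue a b c =
  ¬ (∃[ x ] ∃[ y ] (0ℤ ≤ x × 0ℤ ≤ y × Rep a b c x y))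
  × ¬ (∃[ x ] ∃[ y ] (x ≤ 0ℤ × y ≤ 0ℤ × Rep a b c x y))

module Submission where

-- By coprimality the representations c = x a + y b of a fixed c form one orbit
-- (x + m b, y − m a), m ∈ ℤ. The Frobenius values are exactly the c = r a − s b with
-- 0 < r < b and 0 < s < a; with r′ = b − r and s′ = a − s such a c is also −r′ a + s′ b,
-- and every representation of c arises from one of these two by moving away from the
-- other, which only increases |x| + |y|. Hence ℓ(c) = min(K, a + b − K) for K = r + s,
-- and c = r a + (r − K) b with 0 < r < b, a representation that determines r and K.
-- So ℓ(c) = ⌊(a+b)/2⌋ exactly when K = (a+b)/2 (a + b even) or K = (a+b∓1)/2 (a + b odd).

open import Defs
open import Data.Nat using (ℕ; zero; suc; _<_; _≤_; _∸_; _/_; _⊓_; z≤n; s≤s; NonZero)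
open import Data.Nat.Divisibility using (_∣_; m%n≡0⇒n∣m)
open import Data.Nat.DivMod using (_%_; m*n/n≡m; m/n*n≡m; m≡m%n+[m/n]*n; m%n<n)
open import Data.Nat.Coprimality using (Coprime)
open import Data.Integer using (ℤ; +_; -[1+_]; _+_; _*_; _-_; -_; 0ℤ; 1ℤ; ∣_∣; +≤+; -≤+)
open import Data.Product using (_×_; ∃-syntax; _,_; proj₁; proj₂)
open import Data.Sum using (_⊎_; inj₁; inj₂)
open import Data.Empty using (⊥-elim)
open import Function.Bundles using (_⇔_; mk⇔; Equivalence)
open import Relation.Binary.PropositionalEquality
  using (_≡_; _≢_; refl; sym; trans; cong; cong₂; subst; module ≡-Reasoning)
open import Relation.Nullary using (¬_; yes; no; contradiction)
import Data.Nat as N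
import Data.Integer as Z
import Data.Sum as Sum
import Data.Nat.Properties as NP
import Data.Integer.Properties as ZP
import Data.Nat.Coprimality as NC
import Data.Nat.GCD as NG
import Data.Integer.Divisibility.Signed as ZS
import Data.Integer.Coprimality as ZC
import Data.Integer.DivMod as ZM
open import Data.Integer.Tactic.RingSolver using (solve-∀)
import Data.Nat.Tactic.RingSolver as ℕ-Solver

open Equivalence using (to; from)

m+m≤n+n⇒m≤n : ∀ {m n} → m N.+ m ≤ n N.+ n → m ≤ n
m+m≤n+n⇒m≤n m+m≤n+n = NP.≮⇒≥ λ n<m → NP.<⇒≱ (NP.+-mono-< n<m n<m) m+m≤n+n

n≡m⊓o⇔m≡n : ∀ {m o n} → m N.+ o ≡ n N.+ n → n ≡ m ⊓ o ⇔ m ≡ n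
n≡m⊓o⇔m≡n {m} {o} {n} m+o≡n+n = mk⇔ ⇒ ⇐
  where
  ⇒ : n ≡ m ⊓ o → m ≡ n
  ⇒ n≡ with NP.⊓-sel m o
  ... | inj₁ ⊓≡m = sym (trans n≡ ⊓≡m)
  ... | inj₂ ⊓≡o = NP.+-cancelʳ-≡ n m n (subst (λ t → m N.+ t ≡ n N.+ n) (sym (trans n≡ ⊓≡o)) m+o≡n+n)
  ⇐ : m ≡ n → n ≡ m ⊓ o
  ⇐ refl = sym (trans (cong (n ⊓_) (NP.+-cancelˡ-≡ n o n m+o≡n+n)) (NP.⊓-idem n))

n≡m⊓o⇔m≡n⊎m≡1+n : ∀ {m o n} → m N.+ o ≡ suc (n N.+ n) → n ≡ m ⊓ o ⇔ (m ≡ n ⊎ m ≡ suc n)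
n≡m⊓o⇔m≡n⊎m≡1+n {m} {o} {n} m+o≡1+n+n = mk⇔ ⇒ ⇐
  where
  ⇒ : n ≡ m ⊓ o → m ≡ n ⊎ m ≡ suc n
  ⇒ n≡ with NP.⊓-sel m o
  ... | inj₁ ⊓≡m = inj₁ (sym (trans n≡ ⊓≡m))
  ... | inj₂ ⊓≡o = inj₂ (NP.+-cancelʳ-≡ n m (suc n)
                          (subst (λ t → m N.+ t ≡ suc (n N.+ n)) (sym (trans n≡ ⊓≡o)) m+o≡1+n+n))
  ⇐ : m ≡ n ⊎ m ≡ suc n → n ≡ m ⊓ o
  ⇐ (inj₁ refl) = sym (trans (cong (n ⊓_) o≡1+n) (NP.m≤n⇒m⊓n≡m (NP.n≤1+n n)))
    where
    o≡1+n : o ≡ suc n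
    o≡1+n = NP.+-cancelˡ-≡ n o (suc n) (trans m+o≡1+n+n (sym (NP.+-suc n n)))
  ⇐ (inj₂ refl) = sym (trans (cong (suc n ⊓_) o≡n) (NP.m≥n⇒m⊓n≡n (NP.n≤1+n n)))
    where
    o≡n : o ≡ n
    o≡n = NP.+-cancelˡ-≡ n o n (NP.suc-injective m+o≡1+n+n)

n*2≡n+n : ∀ n → n N.* 2 ≡ n N.+ n
n*2≡n+n n = trans (NP.*-comm n 2) (cong (n N.+_) (NP.+-identityʳ n))

[n+n]/2≡n : ∀ n → (n N.+ n) / 2 ≡ n
[n+n]/2≡n n = trans (cong (_/ 2) (sym (n*2≡n+n n))) (m*n/n≡m n 2)

2∣⇒≡[m/2]+[m/2] : ∀ {m} → 2 ∣ m → m ≡ m / 2 N.+ m / 2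
2∣⇒≡[m/2]+[m/2] {m} 2∣m = trans (sym (m/n*n≡m 2∣m)) (n*2≡n+n (m / 2))

2∤⇒≡1+q+q : ∀ {m} → ¬ 2 ∣ m → ∃[ q ] m ≡ suc (q N.+ q)
2∤⇒≡1+q+q {m} 2∤m with m % 2 in m%2≡ | m%n<n m 2
... | 0           | _ = contradiction (m%n≡0⇒n∣m m 2 m%2≡) 2∤m
... | 1           | _ = m / 2 , trans (m≡m%n+[m/n]*n m 2) (cong₂ N._+_ m%2≡ (n*2≡n+n (m / 2)))
... | suc (suc _) | s≤s (s≤s ())

[m∸1]/2≡q : ∀ {m} q → m ≡ suc (q N.+ q) → (m ∸ 1) / 2 ≡ q
[m∸1]/2≡q q refl = [n+n]/2≡n q

[m+1]/2≡1+q : ∀ {m} q → m ≡ suc (q N.+ q) → (m N.+ 1) / 2 ≡ suc q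
[m+1]/2≡1+q q refl = trans (cong (_/ 2) (regroup q)) ([n+n]/2≡n (suc q))
  where
  regroup : ∀ q → suc (q N.+ q) N.+ 1 ≡ suc q N.+ suc q
  regroup = ℕ-Solver.solve-∀

[m∸1+2s]/2≡q+s : ∀ {m} q s → m ≡ suc (q N.+ q) → (m ∸ 1 N.+ 2 N.* s) / 2 ≡ q N.+ s
[m∸1+2s]/2≡q+s q s refl = trans (cong (_/ 2) (regroup q s)) ([n+n]/2≡n (q N.+ s))
  where
  regroup : ∀ q s → q N.+ q N.+ 2 N.* s ≡ (q N.+ s) N.+ (q N.+ s)
  regroup = ℕ-Solver.solve-∀

1≤m⇒m+n≢0 : ∀ {m n} → 1 ≤ m → m N.+ n ≢ 0
1≤m⇒m+n≢0 (s≤s z≤n) ()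

0≤-+n⇒n≡0 : ∀ {n} → 0ℤ Z.≤ - + n → n ≡ 0
0≤-+n⇒n≡0 {zero}  _  = refl
0≤-+n⇒n≡0 {suc _} ()

+n≤0⇒n≡0 : ∀ {n} → + n Z.≤ 0ℤ → n ≡ 0
+n≤0⇒n≡0 n≤0 = NP.n≤0⇒n≡0 (ZP.drop‿+≤+ n≤0)

i-[i+j]≡-j : ∀ i j → i - (i + j) ≡ - j
i-[i+j]≡-j = solve-∀

∣+m∣+∣-+n∣≡m+n : ∀ m n → ∣ + m ∣ N.+ ∣ - + n ∣ ≡ m N.+ n
∣+m∣+∣-+n∣≡m+n m n = cong (m N.+_) (ZP.∣-i∣≡∣i∣ (+ n))

∣-+m∣+∣+n∣≡m+n : ∀ m n → ∣ - + m ∣ N.+ ∣ + n ∣ ≡ m N.+ n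
∣-+m∣+∣+n∣≡m+n m n = cong (N._+ n) (ZP.∣-i∣≡∣i∣ (+ m))

bézout-ℤ : ∀ x m y n → 1 N.+ y N.* n ≡ x N.* m → 1ℤ ≡ + x * + m + - + y * + n
bézout-ℤ x m y n eq = begin
  1ℤ                          ≡⟨ 1≡[1+i]-i (+ y * + n) ⟩
  1ℤ + + y * + n - + y * + n  ≡⟨ cong (λ t → t - + y * + n) lifted ⟩
  + x * + m - + y * + n       ≡⟨ cong (λ t → + x * + m + t) (ZP.neg-distribˡ-* (+ y) (+ n)) ⟩
  + x * + m + - + y * + n     ∎
  where
  open ≡-Reasoning
  1≡[1+i]-i : ∀ i → 1ℤ ≡ 1ℤ + i - i
  1≡[1+i]-i = solve-∀
  lifted : 1ℤ + + y * + n ≡ + x * + m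
  lifted = trans (cong (λ t → 1ℤ + t) (sym (ZP.pos-* y n))) (trans (cong +_ eq) (ZP.pos-* x m))

module Frobenius (a b : ℕ) .{{_ : NonZero b}} (coprime : Coprime a b) where

  private
    A B : ℤ
    A = + a
    B = + b

  -- Opaque: letting unification unfold these witnesses makes type checking blow up.
  opaque
    Rep⇒shift : ∀ {c} x y x′ y′ → Rep A B c x y → Rep A B c x′ y′ →
                ∃[ m ] (x′ ≡ x + m * B × y′ ≡ y - m * A)
    Rep⇒shift x y x′ y′ rep rep′ = m , x′≡x+mB , y′≡y-mA
      where
      open ≡-Reasoning
      cancel-y′B : ∀ x x′ y′ A B → (x′ - x) * A ≡ x′ * A + y′ * B - (x * A + y′ * B)
      cancel-y′B = solve-∀
      cancel-xA : ∀ x y y′ A B → x * A + y * B - (x * A + y′ * B) ≡ (y - y′) * B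
      cancel-xA = solve-∀
      balance : (x′ - x) * A ≡ (y - y′) * B
      balance = begin
        (x′ - x) * A                        ≡⟨ cancel-y′B x x′ y′ A B ⟩
        x′ * A + y′ * B - (x * A + y′ * B)  ≡⟨ cong (λ t → t - (x * A + y′ * B)) (trans (sym rep′) rep) ⟩
        x * A + y * B - (x * A + y′ * B)    ≡⟨ cancel-xA x y y′ A B ⟩
        (y - y′) * B                        ∎
      B∣x′-x : B ZS.∣ (x′ - x)
      B∣x′-x = ZS.∣ᵤ⇒∣ (ZC.coprime-divisor B A (x′ - x) (NC.sym coprime)
                 (ZS.∣⇒∣ᵤ (ZS.divides (y - y′) (trans (ZP.*-comm A (x′ - x)) balance))))
      m : ℤ
      m = ZS._∣_.quotient B∣x′-x
      x′-x≡mB : x′ - x ≡ m * B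
      x′-x≡mB = ZS._∣_.equality B∣x′-x
      x′≡x+mB : x′ ≡ x + m * B
      x′≡x+mB = trans (x′≡x+[x′-x] x x′) (cong (λ t → x + t) x′-x≡mB)
        where
        x′≡x+[x′-x] : ∀ x x′ → x′ ≡ x + (x′ - x)
        x′≡x+[x′-x] = solve-∀
      y-y′≡mA : y - y′ ≡ m * A
      y-y′≡mA = ZP.*-cancelʳ-≡ (y - y′) (m * A) B (begin
        (y - y′) * B  ≡⟨ balance ⟨
        (x′ - x) * A  ≡⟨ cong (_* A) x′-x≡mB ⟩
        m * B * A     ≡⟨ ZP.*-assoc m B A ⟩
        m * (B * A)   ≡⟨ cong (m *_) (ZP.*-comm B A) ⟩
        m * (A * B)   ≡⟨ ZP.*-assoc m A B ⟨
        m * A * B     ∎)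
      y′≡y-mA : y′ ≡ y - m * A
      y′≡y-mA = trans (y′≡y-[y-y′] y y′) (cong (λ t → y - t) y-y′≡mA)
        where
        y′≡y-[y-y′] : ∀ y y′ → y′ ≡ y - (y - y′)
        y′≡y-[y-y′] = solve-∀

    bézout : ∃[ u ] ∃[ v ] (1ℤ ≡ u * A + v * B)
    bézout with NC.coprime-Bézout coprime
    ... | NG.Bézout.+- x y eq = + x , - + y , bézout-ℤ x a y b eq
    ... | NG.Bézout.-+ x y eq = - + x , + y , trans (bézout-ℤ y b x a eq) (ZP.+-comm (+ y * B) (- + x * A))

    normal-form : ∀ c → ∃[ r ] ∃[ y ] (r < b × Rep A B c (+ r) y)
    normal-form c with bézout
    ... | u , v , 1≡uA+vB = r , c * v + q * A , ZM.n%ℕd<d (c * u) b , (begin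
      c                                ≡⟨ ZP.*-identityʳ c ⟨
      c * 1ℤ                           ≡⟨ cong (c *_) 1≡uA+vB ⟩
      c * (u * A + v * B)              ≡⟨ distrib c u v A B ⟩
      (c * u) * A + (c * v) * B        ≡⟨ cong (λ t → t * A + (c * v) * B) (ZM.a≡a%ℕn+[a/ℕn]*n (c * u) b) ⟩
      (+ r + q * B) * A + (c * v) * B  ≡⟨ regroup (+ r) q (c * v) A B ⟩
      + r * A + (c * v + q * A) * B    ∎)
      where
      open ≡-Reasoning
      r : ℕ
      r = (c * u) ZM.%ℕ b
      q : ℤ
      q = (c * u) ZM./ℕ b
      distrib : ∀ c u v A B → c * (u * A + v * B) ≡ (c * u) * A + (c * v) * B
      distrib = solve-∀
      regroup : ∀ r q w A B → (r + q * B) * A + w * B ≡ r * A + (w + q * A) * B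
      regroup = solve-∀

  private
    r′≡r+nb⇒n≡0 : ∀ {r r′} n → r′ ≡ r N.+ n N.* b → r′ < b → n ≡ 0
    r′≡r+nb⇒n≡0 zero    _    _    = refl
    r′≡r+nb⇒n≡0 {r} (suc n) refl r′<b =
      contradiction (NP.≤-trans (NP.m≤m+n b (n N.* b)) (NP.m≤n+m _ r)) (NP.<⇒≱ r′<b)

  shift<b⇒0 : ∀ {r r′} m → + r′ ≡ + r + m * B → r < b → r′ < b → m ≡ 0ℤ
  shift<b⇒0 {r} (+ n) eq _ r′<b =
    cong +_ (r′≡r+nb⇒n≡0 n (ZP.+-injective (trans eq (cong (λ t → + r + t) (sym (ZP.pos-* n b))))) r′<b)
  shift<b⇒0 {r} {r′} -[1+ n ] eq r<b _ =
    contradiction (r′≡r+nb⇒n≡0 {r′} (suc n) (ZP.+-injective r≡r′+[1+n]b) r<b) λ ()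
    where
    open ≡-Reasoning
    i≡i-jk+jk : ∀ i j B → i ≡ i + - j * B + j * B
    i≡i-jk+jk = solve-∀
    r≡r′+[1+n]b : + r ≡ + r′ + + (suc n N.* b)
    r≡r′+[1+n]b = begin
      + r                               ≡⟨ i≡i-jk+jk (+ r) (+ suc n) B ⟩
      + r + -[1+ n ] * B + + suc n * B  ≡⟨ cong₂ _+_ (sym eq) (sym (ZP.pos-* (suc n) b)) ⟩
      + r′ + + (suc n N.* b)            ∎

  Rep-unique : ∀ {c r r′} y y′ → r < b → r′ < b → Rep A B c (+ r) y → Rep A B c (+ r′) y′ →
               r ≡ r′ × y ≡ y′
  Rep-unique {r = r} {r′} y y′ r<b r′<b rep rep′ = r≡r′ , y≡y′
    where
    shift : ∃[ m ] (+ r′ ≡ + r + m * B × y′ ≡ y - m * A)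
    shift = Rep⇒shift (+ r) y (+ r′) y′ rep rep′
    m≡0 : proj₁ shift ≡ 0ℤ
    m≡0 = shift<b⇒0 (proj₁ shift) (proj₁ (proj₂ shift)) r<b r′<b
    r≡r′ : r ≡ r′
    r≡r′ = sym (trans (ZP.+-injective (trans (proj₁ (proj₂ shift)) (cong (λ m → + r + m * B) m≡0)))
                      (NP.+-identityʳ r))
    y≡y′ : y ≡ y′
    y≡y′ = sym (trans (proj₂ (proj₂ shift)) (trans (cong (λ m → y - m * A) m≡0) (i-0*k≡i y A)))
      where
      i-0*k≡i : ∀ i A → i - 0ℤ * A ≡ i
      i-0*k≡i = solve-∀

  c[_,_] : ℕ → ℕ → ℤ
  c[ α , K ] = + α * A + (+ α - + K) * B

  private
    u+-[1+k]w≡-[u′+kw] : ∀ {u u′ w} k → u N.+ u′ ≡ w → + u + -[1+ k ] * + w ≡ - + (u′ N.+ k N.* w)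
    u+-[1+k]w≡-[u′+kw] {u} {u′} k refl = begin
      + u + -[1+ k ] * (+ u + + u′)  ≡⟨ expand (+ u) (+ u′) (+ k) ⟩
      - (+ u′ + + k * (+ u + + u′))  ≡⟨ cong (λ t → - (+ u′ + t)) (sym (ZP.pos-* k (u N.+ u′))) ⟩
      - + (u′ N.+ k N.* (u N.+ u′))  ∎
      where
      open ≡-Reasoning
      expand : ∀ u u′ k → u + - (1ℤ + k) * (u + u′) ≡ - (u′ + k * (u + u′))
      expand = solve-∀

  module TwoReps {c} (r r′ s s′ : ℕ) (r+r′≡b : r N.+ r′ ≡ b) (s+s′≡a : s N.+ s′ ≡ a)
                 (rep : Rep A B c (+ r) (- + s)) where

    rep′ : Rep A B c (- + r′) (+ s′)
    rep′ = begin
      c                                            ≡⟨ rep ⟩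
      + r * A + - + s * B                          ≡⟨ cong₂ (λ A B → + r * A + - + s * B) (sym A≡) (sym B≡) ⟩
      + r * (+ s + + s′) + - + s * (+ r + + r′)    ≡⟨ swap (+ r) (+ r′) (+ s) (+ s′) ⟩
      - + r′ * (+ s + + s′) + + s′ * (+ r + + r′)  ≡⟨ cong₂ (λ A B → - + r′ * A + + s′ * B) A≡ B≡ ⟩
      - + r′ * A + + s′ * B                        ∎
      where
      open ≡-Reasoning
      A≡ : + s + + s′ ≡ A
      A≡ = cong +_ s+s′≡a
      B≡ : + r + + r′ ≡ B
      B≡ = cong +_ r+r′≡b
      swap : ∀ r r′ s s′ → r * (s + s′) + - s * (r + r′) ≡ - r′ * (s + s′) + s′ * (r + r′)
      swap = solve-∀

    classify : ∀ x y → Rep A B c x y →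
      (∃[ k ] (x ≡ + (r N.+ k N.* b) × y ≡ - + (s N.+ k N.* a)))
      ⊎ (∃[ k ] (x ≡ - + (r′ N.+ k N.* b) × y ≡ + (s′ N.+ k N.* a)))
    classify x y rep″ with Rep⇒shift (+ r) (- + s) x y rep rep″
    ... | + k , x≡ , y≡ = inj₁ (k ,
      trans x≡ (cong (λ t → + r + t) (sym (ZP.pos-* k b))) ,
      trans y≡ (trans (cong (λ t → - + s - t) (sym (ZP.pos-* k a)))
                      (sym (ZP.neg-distrib-+ (+ s) (+ (k N.* a))))))
    ... | -[1+ k ] , x≡ , y≡ = inj₂ (k ,
      trans x≡ (u+-[1+k]w≡-[u′+kw] k r+r′≡b) ,
      trans y≡ (trans (sym (ZP.neg-distrib-+ (+ s) (-[1+ k ] * A)))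
                      (trans (cong -_ (u+-[1+k]w≡-[u′+kw] k s+s′≡a)) (ZP.neg-involutive _))))

    size-bound : ∀ x y → Rep A B c x y → r N.+ s ≤ ∣ x ∣ N.+ ∣ y ∣ ⊎ r′ N.+ s′ ≤ ∣ x ∣ N.+ ∣ y ∣
    size-bound x y rep″ with classify x y rep″
    ... | inj₁ (k , refl , refl) =
      inj₁ (subst (r N.+ s ≤_) (sym (∣+m∣+∣-+n∣≡m+n (r N.+ k N.* b) (s N.+ k N.* a)))
                  (NP.+-mono-≤ (NP.m≤m+n r (k N.* b)) (NP.m≤m+n s (k N.* a))))
    ... | inj₂ (k , refl , refl) =
      inj₂ (subst (r′ N.+ s′ ≤_) (sym (∣-+m∣+∣+n∣≡m+n (r′ N.+ k N.* b) (s′ N.+ k N.* a)))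
                  (NP.+-mono-≤ (NP.m≤m+n r′ (k N.* b)) (NP.m≤m+n s′ (k N.* a))))

    hasLength⇔ : ∀ {n} → HasLength A B c n ⇔ n ≡ (r N.+ s) ⊓ (r′ N.+ s′)
    hasLength⇔ {n} = mk⇔ ⇒ ⇐
      where
      D E : ℕ
      D = r N.+ s
      E = r′ N.+ s′
      ⇒ : HasLength A B c n → n ≡ D ⊓ E
      ⇒ ((x , y , rep″ , size≡n) , minimal) = NP.≤-antisym (NP.⊓-glb n≤D n≤E) ⊓≤n
        where
        n≤D : n ≤ D
        n≤D = subst (n ≤_) (∣+m∣+∣-+n∣≡m+n r s) (minimal (+ r) (- + s) rep)
        n≤E : n ≤ E
        n≤E = subst (n ≤_) (∣-+m∣+∣+n∣≡m+n r′ s′) (minimal (- + r′) (+ s′) rep′)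
        ⊓≤n : D ⊓ E ≤ n
        ⊓≤n with size-bound x y rep″
        ... | inj₁ D≤ = NP.≤-trans (NP.m⊓n≤m D E) (subst (D ≤_) size≡n D≤)
        ... | inj₂ E≤ = NP.≤-trans (NP.m⊓n≤n D E) (subst (E ≤_) size≡n E≤)
      ⇐ : n ≡ D ⊓ E → HasLength A B c n
      ⇐ n≡D⊓E = witness (NP.⊓-sel D E) , minimal
        where
        witness : D ⊓ E ≡ D ⊎ D ⊓ E ≡ E → ∃[ x ] ∃[ y ] (Rep A B c x y × ∣ x ∣ N.+ ∣ y ∣ ≡ n)
        witness (inj₁ ⊓≡D) = + r , - + s , rep , trans (∣+m∣+∣-+n∣≡m+n r s) (sym (trans n≡D⊓E ⊓≡D))
        witness (inj₂ ⊓≡E) = - + r′ , + s′ , rep′ , trans (∣-+m∣+∣+n∣≡m+n r′ s′) (sym (trans n≡D⊓E ⊓≡E))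
        minimal : ∀ x y → Rep A B c x y → n ≤ ∣ x ∣ N.+ ∣ y ∣
        minimal x y rep″ with size-bound x y rep″
        ... | inj₁ D≤ = subst (_≤ _) (sym n≡D⊓E) (NP.≤-trans (NP.m⊓n≤m D E) D≤)
        ... | inj₂ E≤ = subst (_≤ _) (sym n≡D⊓E) (NP.≤-trans (NP.m⊓n≤n D E) E≤)

    isFrobeniusValue : 1 ≤ r → 1 ≤ r′ → 1 ≤ s → 1 ≤ s′ → IsFrobeniusValue A B c
    isFrobeniusValue 1≤r 1≤r′ 1≤s 1≤s′ = ¬nonneg , ¬nonpos
      where
      ¬nonneg : ¬ (∃[ x ] ∃[ y ] (0ℤ Z.≤ x × 0ℤ Z.≤ y × Rep A B c x y))
      ¬nonneg (x , y , 0≤x , 0≤y , rep″) with classify x y rep″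
      ... | inj₁ (k , _ , refl) = 1≤m⇒m+n≢0 1≤s (0≤-+n⇒n≡0 0≤y)
      ... | inj₂ (k , refl , _) = 1≤m⇒m+n≢0 1≤r′ (0≤-+n⇒n≡0 0≤x)
      ¬nonpos : ¬ (∃[ x ] ∃[ y ] (x Z.≤ 0ℤ × y Z.≤ 0ℤ × Rep A B c x y))
      ¬nonpos (x , y , x≤0 , y≤0 , rep″) with classify x y rep″
      ... | inj₁ (k , refl , _) = 1≤m⇒m+n≢0 1≤r (+n≤0⇒n≡0 x≤0)
      ... | inj₂ (k , _ , refl) = 1≤m⇒m+n≢0 1≤s′ (+n≤0⇒n≡0 y≤0)

    sizes-sum : (r N.+ s) N.+ (r′ N.+ s′) ≡ a N.+ b
    sizes-sum = begin
      (r N.+ s) N.+ (r′ N.+ s′)  ≡⟨ regroup r s r′ s′ ⟩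
      (s N.+ s′) N.+ (r N.+ r′)  ≡⟨ cong₂ N._+_ s+s′≡a r+r′≡b ⟩
      a N.+ b                    ∎
      where
      open ≡-Reasoning
      regroup : ∀ r s r′ s′ → (r N.+ s) N.+ (r′ N.+ s′) ≡ (s N.+ s′) N.+ (r N.+ r′)
      regroup = ℕ-Solver.solve-∀

    c≡c[r,r+s] : c ≡ c[ r , r N.+ s ]
    c≡c[r,r+s] = trans rep (cong (λ t → + r * A + t * B) (sym (i-[i+j]≡-j (+ r) (+ s))))

  record FrobeniusForm (c : ℤ) : Set where
    field
      r r′ s s′ : ℕ
      r+r′≡b    : r N.+ r′ ≡ b
      s+s′≡a    : s N.+ s′ ≡ a
      rep       : Rep A B c (+ r) (- + s)
      1≤r       : 1 ≤ r
      1≤r′      : 1 ≤ r′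
      1≤s       : 1 ≤ s
      1≤s′      : 1 ≤ s′

    open TwoReps r r′ s s′ r+r′≡b s+s′≡a rep public

    r<b : r < b
    r<b = subst (r <_) r+r′≡b (NP.m<m+n r 1≤r′)

  frobenius⇒form : ∀ {c} → IsFrobeniusValue A B c → FrobeniusForm c
  frobenius⇒form {c} (¬nonneg , ¬nonpos) with normal-form c
  ... | r , + k , _ , rep = ⊥-elim (¬nonneg (+ r , + k , +≤+ z≤n , +≤+ z≤n , rep))
  ... | zero , -[1+ j ] , _ , rep = ⊥-elim (¬nonpos (0ℤ , -[1+ j ] , ZP.≤-refl , -≤+ , rep))
  ... | suc r , -[1+ j ] , r<b , rep with suc j N.<? a
  ...   | yes s<a = record
    { r = suc r ; r′ = b ∸ suc r ; s = suc j ; s′ = a ∸ suc j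
    ; r+r′≡b = NP.m+[n∸m]≡n (NP.<⇒≤ r<b) ; s+s′≡a = NP.m+[n∸m]≡n (NP.<⇒≤ s<a) ; rep = rep
    ; 1≤r = s≤s z≤n ; 1≤r′ = NP.m<n⇒0<n∸m r<b ; 1≤s = s≤s z≤n ; 1≤s′ = NP.m<n⇒0<n∸m s<a
    }
  ...   | no s≮a = ⊥-elim (¬nonpos (+ suc r - B , A - + suc j ,
                     ZP.i≤j⇒i-j≤0 (+≤+ (NP.<⇒≤ r<b)) , ZP.i≤j⇒i-j≤0 (+≤+ (NP.≮⇒≥ s≮a)) ,
                     trans rep (shift-back (+ suc r) (+ suc j) A B)))
    where
    shift-back : ∀ r s A B → r * A + - s * B ≡ (r - B) * A + (A - s) * B
    shift-back = solve-∀

  c[]-form : ∀ {α K} → 1 ≤ α → α < b → α < K → K < α N.+ a → FrobeniusForm c[ α , K ]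
  c[]-form {α} {K} 1≤α α<b α<K K<α+a = record
    { r = α ; r′ = b ∸ α ; s = K ∸ α ; s′ = a ∸ (K ∸ α)
    ; r+r′≡b = NP.m+[n∸m]≡n (NP.<⇒≤ α<b) ; s+s′≡a = NP.m+[n∸m]≡n (NP.<⇒≤ K∸α<a)
    ; rep = cong (λ t → + α * A + t * B) α-K≡-[K∸α]
    ; 1≤r = 1≤α ; 1≤r′ = NP.m<n⇒0<n∸m α<b ; 1≤s = NP.m<n⇒0<n∸m α<K ; 1≤s′ = NP.m<n⇒0<n∸m K∸α<a
    }
    where
    α+[K∸α]≡K : α N.+ (K ∸ α) ≡ K
    α+[K∸α]≡K = NP.m+[n∸m]≡n (NP.<⇒≤ α<K)
    K∸α<a : K ∸ α < a
    K∸α<a = NP.+-cancelˡ-< α (K ∸ α) a (subst (_< α N.+ a) (sym α+[K∸α]≡K) K<α+a)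
    α-K≡-[K∸α] : + α - + K ≡ - + (K ∸ α)
    α-K≡-[K∸α] = trans (cong (λ t → + α - + t) (sym α+[K∸α]≡K)) (i-[i+j]≡-j (+ α) (+ (K ∸ α)))

  frobenius⇒c[] : ∀ {c n} → IsFrobeniusValue A B c → HasLength A B c n →
    ∃[ α ] ∃[ K ] ∃[ E ] (1 ≤ α × α ≤ b ∸ 1 × K N.+ E ≡ a N.+ b × n ≡ K ⊓ E × c ≡ c[ α , K ])
  frobenius⇒c[] frob len =
    r , r N.+ s , r′ N.+ s′ , 1≤r , NP.<⇒≤pred r<b , sizes-sum , to hasLength⇔ len , c≡c[r,r+s]
    where open FrobeniusForm (frobenius⇒form frob)

  c[]⇒frobenius : ∀ {α K n} → 1 ≤ α → α ≤ b ∸ 1 → b ≤ K → K ≤ a →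
    (∀ {E} → K N.+ E ≡ a N.+ b → n ≡ K ⊓ E) →
    IsFrobeniusValue A B c[ α , K ] × HasLength A B c[ α , K ] n
  c[]⇒frobenius {α} {K} {n} 1≤α α≤b-1 b≤K K≤a n≡K⊓ =
    isFrobeniusValue 1≤r 1≤r′ 1≤s 1≤s′ ,
    from hasLength⇔ (subst (λ D → n ≡ D ⊓ (r′ N.+ s′)) (sym r+s≡K)
                       (n≡K⊓ (subst (λ D → D N.+ (r′ N.+ s′) ≡ a N.+ b) r+s≡K sizes-sum)))
    where
    α<b : α < b
    α<b = NP.m≤pred[n]⇒suc[m]≤n α≤b-1
    α<K : α < K
    α<K = NP.<-≤-trans α<b b≤K
    open FrobeniusForm (c[]-form 1≤α α<b α<K (NP.≤-<-trans K≤a (NP.m<n+m a 1≤α)))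
    r+s≡K : α N.+ (K ∸ α) ≡ K
    r+s≡K = NP.m+[n∸m]≡n (NP.<⇒≤ α<K)

  c[]-injective : ∀ {α β} K L → α < b → β < b → c[ α , K ] ≡ c[ β , L ] → α ≡ β × K ≡ L
  c[]-injective {α} {β} K L α<b β<b eq
    with Rep-unique (+ α - + K) (+ β - + L) α<b β<b refl eq
  ... | refl , α-K≡α-L = refl , ZP.+-injective (begin
    + K                ≡⟨ j≡i-[i-j] (+ α) (+ K) ⟩
    + α - (+ α - + K)  ≡⟨ cong (λ t → + α - t) α-K≡α-L ⟩
    + α - (+ α - + L)  ≡⟨ j≡i-[i-j] (+ α) (+ L) ⟨
    + L                ∎)
    where
    open ≡-Reasoning
    j≡i-[i-j] : ∀ i j → j ≡ i - (i - j)
    j≡i-[i-j] = solve-∀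

  module _ (b<a : b < a) where

    even-case : ∀ n → a N.+ b ≡ n N.+ n → ∀ c →
      (IsFrobeniusValue A B c × HasLength A B c n) ⇔ (∃[ α ] (1 ≤ α × α ≤ b ∸ 1 × c ≡ c[ α , n ]))
    even-case n a+b≡n+n _ = mk⇔ ⇒ ⇐
      where
      b≤n : b ≤ n
      b≤n = m+m≤n+n⇒m≤n (subst (b N.+ b ≤_) a+b≡n+n (NP.+-monoˡ-≤ b (NP.<⇒≤ b<a)))
      n≤a : n ≤ a
      n≤a = m+m≤n+n⇒m≤n (subst (_≤ a N.+ a) a+b≡n+n (NP.+-monoʳ-≤ a (NP.<⇒≤ b<a)))
      ⇒ : ∀ {c} → IsFrobeniusValue A B c × HasLength A B c n →
          ∃[ α ] (1 ≤ α × α ≤ b ∸ 1 × c ≡ c[ α , n ])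
      ⇒ (frob , len) with frobenius⇒c[] frob len
      ... | α , K , E , 1≤α , α≤b-1 , K+E≡a+b , n≡K⊓E , c≡ =
        α , 1≤α , α≤b-1 , trans c≡ (cong c[ α ,_] (to (n≡m⊓o⇔m≡n (trans K+E≡a+b a+b≡n+n)) n≡K⊓E))
      ⇐ : ∀ {c} → ∃[ α ] (1 ≤ α × α ≤ b ∸ 1 × c ≡ c[ α , n ]) →
          IsFrobeniusValue A B c × HasLength A B c n
      ⇐ (α , 1≤α , α≤b-1 , refl) =
        c[]⇒frobenius 1≤α α≤b-1 b≤n n≤a λ n+E≡a+b → from (n≡m⊓o⇔m≡n (trans n+E≡a+b a+b≡n+n)) refl

    odd-case : ∀ n n⁺ → a N.+ b ≡ suc (n N.+ n) → n⁺ ≡ suc n → ∀ c →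
      (IsFrobeniusValue A B c × HasLength A B c n)
      ⇔ (∃[ α ] (1 ≤ α × α ≤ b ∸ 1 × (c ≡ c[ α , n ] ⊎ c ≡ c[ α , n⁺ ])))
    odd-case n .(suc n) a+b≡1+n+n refl _ = mk⇔ ⇒ ⇐
      where
      b≤n : b ≤ n
      b≤n = m+m≤n+n⇒m≤n (NP.≤-pred (subst (b N.+ b <_) a+b≡1+n+n (NP.+-monoˡ-< b b<a)))
      1+n≤a : suc n ≤ a
      1+n≤a = m+m≤n+n⇒m≤n (subst (_≤ a N.+ a) (cong suc (trans a+b≡1+n+n (sym (NP.+-suc n n))))
                                  (NP.+-monoʳ-< a b<a))
      n≡K⊓E⇔ : ∀ {K E} → K N.+ E ≡ a N.+ b → n ≡ K ⊓ E ⇔ (K ≡ n ⊎ K ≡ suc n)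
      n≡K⊓E⇔ K+E≡a+b = n≡m⊓o⇔m≡n⊎m≡1+n (trans K+E≡a+b a+b≡1+n+n)
      ⇒ : ∀ {c} → IsFrobeniusValue A B c × HasLength A B c n →
          ∃[ α ] (1 ≤ α × α ≤ b ∸ 1 × (c ≡ c[ α , n ] ⊎ c ≡ c[ α , suc n ]))
      ⇒ (frob , len) with frobenius⇒c[] frob len
      ... | α , K , E , 1≤α , α≤b-1 , K+E≡a+b , n≡K⊓E , c≡ =
        α , 1≤α , α≤b-1 ,
        Sum.map (λ K≡n → trans c≡ (cong c[ α ,_] K≡n)) (λ K≡1+n → trans c≡ (cong c[ α ,_] K≡1+n))
                (to (n≡K⊓E⇔ K+E≡a+b) n≡K⊓E)
      ⇐ : ∀ {c} → ∃[ α ] (1 ≤ α × α ≤ b ∸ 1 × (c ≡ c[ α , n ] ⊎ c ≡ c[ α , suc n ])) →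
          IsFrobeniusValue A B c × HasLength A B c n
      ⇐ (α , 1≤α , α≤b-1 , inj₁ refl) =
        c[]⇒frobenius 1≤α α≤b-1 b≤n (NP.<⇒≤ 1+n≤a) λ K+E≡a+b → from (n≡K⊓E⇔ K+E≡a+b) (inj₁ refl)
      ⇐ (α , 1≤α , α≤b-1 , inj₂ refl) =
        c[]⇒frobenius 1≤α α≤b-1 (NP.m≤n⇒m≤1+n b≤n) 1+n≤a λ K+E≡a+b → from (n≡K⊓E⇔ K+E≡a+b) (inj₂ refl)

lemma4 : (a b : ℕ) → Coprime a b → 1 ≤ b → b < a →
  ((2 ∣ (a N.+ b)) →
    ((c : ℤ) →
      (IsFrobeniusValue (+ a) (+ b) c × HasLength (+ a) (+ b) c ((a N.+ b) / 2))
      ⇔ (∃[ α ] (1 ≤ α × α ≤ b ∸ 1 ×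
           c ≡ (+ α) Z.* (+ a) Z.+ ((+ α) - (+ ((a N.+ b) / 2))) Z.* (+ b))))
    × (∀ α β → 1 ≤ α → α ≤ b ∸ 1 → 1 ≤ β → β ≤ b ∸ 1 →
         (+ α) Z.* (+ a) Z.+ ((+ α) - (+ ((a N.+ b) / 2))) Z.* (+ b)
           ≡ (+ β) Z.* (+ a) Z.+ ((+ β) - (+ ((a N.+ b) / 2))) Z.* (+ b)
         → α ≡ β))
  × ((¬ (2 ∣ (a N.+ b))) →
    ((c : ℤ) →
      (IsFrobeniusValue (+ a) (+ b) c × HasLength (+ a) (+ b) c ((a N.+ b ∸ 1) / 2))
      ⇔ (∃[ α ] (1 ≤ α × α ≤ b ∸ 1 ×
           (c ≡ (+ α) Z.* (+ a) Z.+ ((+ α) - (+ ((a N.+ b ∸ 1) / 2))) Z.* (+ b)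
            ⊎ c ≡ (+ α) Z.* (+ a) Z.+ ((+ α) - (+ ((a N.+ b N.+ 1) / 2))) Z.* (+ b)))))
    × (∀ (s t : ℕ) α β → s ≤ 1 → t ≤ 1 →
         1 ≤ α → α ≤ b ∸ 1 → 1 ≤ β → β ≤ b ∸ 1 →
         (+ α) Z.* (+ a) Z.+ ((+ α) - (+ ((a N.+ b ∸ 1 N.+ 2 N.* s) / 2))) Z.* (+ b)
           ≡ (+ β) Z.* (+ a) Z.+ ((+ β) - (+ ((a N.+ b ∸ 1 N.+ 2 N.* t) / 2))) Z.* (+ b)
         → (s ≡ t × α ≡ β)))
lemma4 a zero _ () _
lemma4 a b@(suc _) coprime _ b<a =
  (λ 2∣a+b → even-case b<a n (2∣⇒≡[m/2]+[m/2] 2∣a+b) ,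
             λ _ _ _ α≤b-1 _ β≤b-1 eq → proj₁ (c[]-injective n n (s≤s α≤b-1) (s≤s β≤b-1) eq)) ,
  (λ 2∤a+b → let (q , a+b≡1+q+q) = 2∤⇒≡1+q+q 2∤a+b
                 n≡q = [m∸1]/2≡q q a+b≡1+q+q
                 K≡q+ = λ s → [m∸1+2s]/2≡q+s q s a+b≡1+q+q
             in odd-case b<a n⁻ n⁺ (trans a+b≡1+q+q (cong (λ t → suc (t N.+ t)) (sym n≡q)))
                             (trans ([m+1]/2≡1+q q a+b≡1+q+q) (cong suc (sym n≡q))) ,
                λ s t _ _ _ _ _ α≤b-1 _ β≤b-1 eq →
                  let (α≡β , K≡L) = c[]-injective (K s) (K t) (s≤s α≤b-1) (s≤s β≤b-1) eq
                  in NP.+-cancelˡ-≡ q s t (trans (sym (K≡q+ s)) (trans K≡L (K≡q+ t))) , α≡β)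
  where
  open Frobenius a b coprime
  n n⁻ n⁺ : ℕ
  n = (a N.+ b) / 2
  n⁻ = (a N.+ b ∸ 1) / 2
  n⁺ = (a N.+ b N.+ 1) / 2
  K : ℕ → ℕ
  K s = (a N.+ b ∸ 1 N.+ 2 N.* s) / 2
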